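{- Every prime implicate of a hydra formula $\varphi$ is a clause of $\varphi$.
   Context: A definite Horn clause is a disjunction of literals with exactly one unnegated literal; it is written as an implication, e.g. $\bar x\vee\bar y\vee z$ as $x,y\to z$, where the variables of the negated literals form the body and the unnegated variable is the head. A definite 3-Horn formula is a conjunction of definite Horn clauses with 3 literals. A clause $C$ is an implicate of $\varphi$ if every truth assignment satisfying $\varphi$ satisfies $C$; it is a prime implicate if no proper subclause of $C$ is an implicate. A hydra formula is a definite 3-Horn formula such that for every clause $x,y\to z$ in $\varphi$ and every variable $u$ (other than $x,y$), the clause $x,y\to u$ also belongs to $\varphi$ (trivial clauses such as $x,y\to x$ are omitted). -}

module Defs where

open import Data.Nat using (ℕ)
open import Data.Fin using (Fin)
open import Data.Bool using (Bool; true; false)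
open import Data.List using (List; []; _∷_)
open import Data.List.Membership.Propositional using (_∈_; _∉_)
open import Data.List.Relation.Unary.Any using (Any)
open import Data.List.Relation.Unary.All using (All)
open import Data.Product using (_×_; _,_; ∃; ∃-syntax; Σ-syntax)
open import Relation.Binary.PropositionalEquality using (_≡_; _≢_)
open import Relation.Nullary using (¬_)
open import Function.Bundles using (_⇔_)

Var : ℕ → Set
Var n = Fin n

data Literal (n : ℕ) : Set where
  pos : Var n → Literal n
  neg : Var n → Literal n

Assignment : ℕ → Set
Assignment n = Var n → Bool

SatLit : ∀ {n} → Assignment n → Literal n → Set
SatLit α (pos x) = α x ≡ true
SatLit α (neg x) = α x ≡ false

-- A clause is a (finite) set of literals, represented by a list and
-- compared by membership only (order and repetitions irrelevant).
Clause : ℕ → Set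
Clause n = List (Literal n)

SatClause : ∀ {n} → Assignment n → Clause n → Set
SatClause α C = Any (SatLit α) C

NonTautological : ∀ {n} → Clause n → Set
NonTautological {n} C = ∀ (x : Var n) → ¬ (pos x ∈ C × neg x ∈ C)

-- Definite Horn clause with 3 literals  x , y → z  (i.e. ¬x ∨ ¬y ∨ z),
-- stored as the triple (x , y , z).
HornClause : ℕ → Set
HornClause n = Var n × Var n × Var n

toClause : ∀ {n} → HornClause n → Clause n
toClause (x , y , z) = neg x ∷ neg y ∷ pos z ∷ []

body : ∀ {n} → HornClause n → List (Var n)
body (x , y , z) = x ∷ y ∷ []

head : ∀ {n} → HornClause n → Var n
head (x , y , z) = z

Is3Horn : ∀ {n} → HornClause n → Set
Is3Horn (x , y , z) = (x ≢ y) × (z ≢ x) × (z ≢ y)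

Formula : ℕ → Set
Formula n = List (HornClause n)

SatFormula : ∀ {n} → Assignment n → Formula n → Set
SatFormula α φ = All (λ c → SatClause α (toClause c)) φ

Definite3Horn : ∀ {n} → Formula n → Set
Definite3Horn φ = All Is3Horn φ

IsHydra : ∀ {n} → Formula n → Set
IsHydra {n} φ =
  Definite3Horn φ ×
  (∀ (c : HornClause n) → c ∈ φ → ∀ (u : Var n) → u ∉ body c →
     ∃[ c' ] (c' ∈ φ × (∀ v → v ∈ body c' ⇔ v ∈ body c) × head c' ≡ u))

Implicate : ∀ {n} → Formula n → Clause n → Set
Implicate {n} φ C = ∀ (α : Assignment n) → SatFormula α φ → SatClause α C

ProperSubclause : ∀ {n} → Clause n → Clause n → Set
ProperSubclause D C = (∀ ℓ → ℓ ∈ D → ℓ ∈ C) × ∃[ ℓ ] (ℓ ∈ C × ℓ ∉ D)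

PrimeImplicate : ∀ {n} → Formula n → Clause n → Set
PrimeImplicate {n} φ C =
  NonTautological C × Implicate φ C ×
  (∀ (D : Clause n) → ProperSubclause D C → ¬ Implicate φ D)

ClauseOf : ∀ {n} → Formula n → Clause n → Set
ClauseOf {n} φ C = ∃[ c ] (c ∈ φ × (∀ (ℓ : Literal n) → ℓ ∈ C ⇔ ℓ ∈ toClause c))

-- Let C be a prime implicate. The assignment making exactly the variables negated in C true
-- falsifies C, so it falsifies some clause x , y → z of φ; hence ¬x and ¬y lie in C. The
-- all-true assignment satisfies every definite Horn formula, so C also contains a positive
-- literal p, which differs from x and y because C is not tautological. The hydra property
-- provides a clause x , y → p in φ. It is an implicate contained in C, so by primality it
-- is C.
module Submission where

open import Defs
open import Data.Nat using (ℕ)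
open import Data.Bool using (true; false)
open import Data.Fin.Properties using () renaming (_≟_ to _≟ᶠ_)
open import Data.List using ([]; _∷_)
open import Data.List.Relation.Unary.Any using (here; there; any?)
open import Data.List.Relation.Unary.All using ([]; _∷_; lookup)
open import Data.List.Relation.Unary.All.Properties using (¬All⇒Any¬)
open import Data.List.Membership.Propositional using (_∈_; find)
open import Data.List.Relation.Binary.Subset.Propositional using (_⊆_)
open import Data.Product using (_×_; _,_; ∃-syntax)
open import Relation.Binary.PropositionalEquality using (refl; cong)
open import Relation.Binary.Definitions using (DecidableEquality)
open import Relation.Nullary using (¬_; Dec; yes; no; does)
open import Relation.Nullary.Decidable using (map′)
open import Data.Empty using (⊥-elim)
open import Function.Bundles using (Equivalence; mk⇔)
import Data.Bool.Properties as Bool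
import Data.List.Membership.DecPropositional as DecMembership

module _ {n : ℕ} where

  _≟ˡ_ : DecidableEquality (Literal n)
  pos x ≟ˡ pos y = map′ (cong pos) (λ { refl → refl }) (x ≟ᶠ y)
  pos x ≟ˡ neg y = no λ ()
  neg x ≟ˡ pos y = no λ ()
  neg x ≟ˡ neg y = map′ (cong neg) (λ { refl → refl }) (x ≟ᶠ y)

  open DecMembership _≟ˡ_ using (_∈?_)

  satLit? : (α : Assignment n) (ℓ : Literal n) → Dec (SatLit α ℓ)
  satLit? α (pos x) = α x Bool.≟ true
  satLit? α (neg x) = α x Bool.≟ false

  falsifier : Clause n → Assignment n
  falsifier C x = does (neg x ∈? C)

  falsifier-true⇒neg∈ : ∀ C x → ¬ SatLit (falsifier C) (neg x) → neg x ∈ C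
  falsifier-true⇒neg∈ C x x-true with neg x ∈? C
  ... | yes ¬x∈C = ¬x∈C
  ... | no  _    = ⊥-elim (x-true refl)

  falsifier-falsifies-literal : ∀ {C : Clause n} → NonTautological C → ∀ {ℓ} → ℓ ∈ C →
                                ¬ SatLit (falsifier C) ℓ
  falsifier-falsifies-literal {C} nonTaut {pos x} x∈C x-true with neg x ∈? C
  ... | yes ¬x∈C = nonTaut x (x∈C , ¬x∈C)
  falsifier-falsifies-literal {C} nonTaut {neg x} ¬x∈C x-false with neg x ∈? C
  ... | no ¬x∉C = ¬x∉C ¬x∈C

  falsifier-falsifies : ∀ {C : Clause n} → NonTautological C → ¬ SatClause (falsifier C) C
  falsifier-falsifies nonTaut sat =
    let _ , ℓ∈C , ℓ-sat = find sat in falsifier-falsifies-literal nonTaut ℓ∈C ℓ-sat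

  falsified-clause : ∀ α (φ : Formula n) → ¬ SatFormula α φ →
                     ∃[ c ] (c ∈ φ × ¬ SatClause α (toClause c))
  falsified-clause α φ unsat =
    find (¬All⇒Any¬ (λ c → any? (satLit? α) (toClause c)) φ unsat)

  implicate-falsified-clause : ∀ {φ : Formula n} {C} → NonTautological C → Implicate φ C →
                               ∃[ c ] (c ∈ φ × ¬ SatClause (falsifier C) (toClause c))
  implicate-falsified-clause {φ} {C} nonTaut implicate =
    falsified-clause (falsifier C) φ (λ sat → falsifier-falsifies nonTaut (implicate (falsifier C) sat))

  falsified-body : ∀ {α : Assignment n} (c : HornClause n) → ¬ SatClause α (toClause c) →
                   ∀ {v} → v ∈ body c → ¬ SatLit α (neg v)
  falsified-body c unsat (here refl)         v-false = unsat (here v-false)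
  falsified-body c unsat (there (here refl)) v-false = unsat (there (here v-false))

  falsified-body-negated : ∀ {C : Clause n} (c : HornClause n) →
                           ¬ SatClause (falsifier C) (toClause c) →
                           ∀ {v} → v ∈ body c → neg v ∈ C
  falsified-body-negated {C} c unsat {v} v∈body =
    falsifier-true⇒neg∈ C v (falsified-body c unsat v∈body)

  all-true-satisfies : (φ : Formula n) → SatFormula (λ _ → true) φ
  all-true-satisfies []      = []
  all-true-satisfies (c ∷ φ) = there (there (here refl)) ∷ all-true-satisfies φ

  implicate-has-positive : ∀ {φ : Formula n} {C} → Implicate φ C → ∃[ p ] (pos p ∈ C)
  implicate-has-positive {φ} implicate with find (implicate (λ _ → true) (all-true-satisfies φ))
  ... | pos p , p∈C , _ = p , p∈C

  clause-implicate : ∀ {φ : Formula n} {c} → c ∈ φ → Implicate φ (toClause c)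
  clause-implicate c∈φ α sat = lookup sat c∈φ

  toClause-⊆ : ∀ {C : Clause n} (c : HornClause n) →
               (∀ {v} → v ∈ body c → neg v ∈ C) → pos (head c) ∈ C → toClause c ⊆ C
  toClause-⊆ c body⊆C head∈C (here refl)                 = body⊆C (here refl)
  toClause-⊆ c body⊆C head∈C (there (here refl))         = body⊆C (there (here refl))
  toClause-⊆ c body⊆C head∈C (there (there (here refl))) = head∈C

  implicate-⊆-prime : ∀ {φ : Formula n} {C D} → PrimeImplicate φ C → Implicate φ D → D ⊆ C → C ⊆ D
  implicate-⊆-prime {D = D} (_ , _ , prime) implicate D⊆C {ℓ} ℓ∈C with ℓ ∈? D
  ... | yes ℓ∈D = ℓ∈D
  ... | no  ℓ∉D = ⊥-elim (prime D ((λ _ → D⊆C) , ℓ , ℓ∈C , ℓ∉D) implicate)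

proposition2p7 : ∀ (n : ℕ) (φ : Formula n) (C : Clause n) →
    IsHydra φ → PrimeImplicate φ C → ClauseOf φ C
proposition2p7 n φ C (_ , hydra) primeImp@(nonTaut , implicate , _)
  with implicate-falsified-clause nonTaut implicate | implicate-has-positive implicate
... | c , c∈φ , falsified | p , p∈C
  with hydra c c∈φ p (λ p∈body → nonTaut p (p∈C , falsified-body-negated c falsified p∈body))
... | c′ , c′∈φ , sameBody , refl =
  c′ , c′∈φ , λ ℓ → mk⇔ (implicate-⊆-prime primeImp (clause-implicate c′∈φ) c′⊆C) c′⊆C
  where
  c′⊆C : toClause c′ ⊆ C
  c′⊆C = toClause-⊆ c′ body′⊆C p∈C
    where
    body′⊆C : ∀ {v} → v ∈ body c′ → neg v ∈ C
    body′⊆C v∈body′ = falsified-body-negated c falsified (Equivalence.to (sameBody _) v∈body′)
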